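{- Suppose $\sigma$ is a cycle of length at least $3$ produced from a rooted-signed-binary tree $T$ by the insertion construction. If $\sigma(i)-i=1$, then there is a tree obtained from $T$ by allowed tree rotations that has a positively signed leaf in relative position $i$; if $\sigma(i)-i=-1$, then there is a tree obtained from $T$ by allowed tree rotations that has a negatively signed leaf in relative position $i-1$.
   Context: A rooted-signed-binary tree is a finite rooted binary tree (each node has at most one left and at most one right child) in which every non-root node has a sign $+$ or $-$; the root is unsigned. Rotations: if $c$ is the left child of $v$, a right rotation at $v$ puts $c$ in $v$'s place, makes $v$ the right child of $c$, and makes the former right subtree of $c$ the left subtree of $v$; the left rotation is its inverse. A rotation is allowed if either $v$ is not the root and $v$ and the child $c$ rotating into its place have the same sign, or $v$ is the root, in which case $c$ becomes the new unsigned root and $v$ gets the sign $c$ had. A tree with $m$ nodes has $m+1$ empty child slots, ordered left to right in symmetric (in-order) order. A non-root leaf $v$ of $T$ is in relative position $i$ if it occupies the $i$-th empty slot of $T-\{v\}$ ($T$ with $v$ deleted). Construction: let $\xi_m(k)=k$ for $k<m$ and $\xi_m(k)=k+1$ for $k\ge m$. For a permutation $s_1\cdots s_n$ and $1\le i\le n$, positive insertion at $i$ gives $\xi_{i+1}(s_1)\cdots \xi_{i+1}(s_{i-1})\,(i{+}1)\,\xi_{i+1}(s_{i})\cdots \xi_{i+1}(s_{n})$, negative insertion at $i$ gives $\xi_{i}(s_1)\cdots \xi_{i}(s_{i})\,(i)\,\xi_{i}(s_{i+1})\cdots \xi_{i}(s_{n})$. Starting with $21$ for the root alone, process the non-root nodes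 in an order where each node follows its non-root parent; when $v$ is processed, with relative position $i$ in the tree formed by the root, the nodes processed so far and $v$, apply the positive or negative insertion at $i$ according to the sign of $v$. The resulting permutation is the cycle produced. -}

module Defs where

open import Data.Nat using (ℕ; zero; suc; _+_; _∸_; _<ᵇ_)
open import Data.Bool using (if_then_else_)
open import Data.List using (List; []; _∷_; map; take; drop; _++_)
open import Data.Maybe using (Maybe; just; nothing)
open import Data.Product using (Σ)
open import Relation.Binary.Construct.Closure.ReflexiveTransitive using (Star)

data Sign : Set where
  plus minus : Sign

-- Signed (non-root) subtrees; `nil` is an empty child slot.
data STree : Set where
  nil  : STree
  node : Sign → STree → STree → STree

data RTree : Set where
  root : STree → STree → RTree

slots : STree → ℕ
slots nil = 1
slots (node _ l r) = slots l + slots r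

-- Ins s i T T' : T' is obtained from T by putting a new leaf of sign s into
-- the i-th (1-based, in-order) empty slot of T.  Equivalently, T' has a
-- non-root leaf of sign s in relative position i, and deleting it gives T.
data Ins (s : Sign) : ℕ → STree → STree → Set where
  here  : Ins s 1 nil (node s nil nil)
  goL   : ∀ {i t l l' r} → Ins s i l l' → Ins s i (node t l r) (node t l' r)
  goR   : ∀ {i t l r r'} → Ins s i r r' → Ins s (slots l + i) (node t l r) (node t l r')

data RIns (s : Sign) : ℕ → RTree → RTree → Set where
  goL : ∀ {i l l' r} → Ins s i l l' → RIns s i (root l r) (root l' r)
  goR : ∀ {i l r r'} → Ins s i r r' → RIns s (slots l + i) (root l r) (root l r')

HasLeafAt : Sign → ℕ → RTree → Set
HasLeafAt s i T = Σ RTree (λ T₀ → RIns s i T₀ T)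

-- Allowed single rotations (anywhere in the tree).
-- Non-root rotations: v and the child c rotating into its place have the same sign.
data Rot : STree → STree → Set where
  rotR : ∀ {s a b c} → Rot (node s (node s a b) c) (node s a (node s b c))
  rotL : ∀ {s a b c} → Rot (node s a (node s b c)) (node s (node s a b) c)
  inL  : ∀ {t l l' r} → Rot l l' → Rot (node t l r) (node t l' r)
  inR  : ∀ {t l r r'} → Rot r r' → Rot (node t l r) (node t l r')

-- Rotations on a rooted tree: at the root the child becomes the new unsigned
-- root and the old root receives the sign the child had.
data RRot : RTree → RTree → Set where
  rootR : ∀ {s a b c} → RRot (root (node s a b) c) (root a (node s b c))
  rootL : ∀ {s a b c} → RRot (root a (node s b c)) (root (node s a b) c)
  inL   : ∀ {l l' r} → Rot l l' → RRot (root l r) (root l' r)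
  inR   : ∀ {l r r'} → Rot r r' → RRot (root l r) (root l r')

Reachable : RTree → RTree → Set
Reachable = Star RRot

ξ : ℕ → ℕ → ℕ
ξ m k = if k <ᵇ m then k else suc k

-- Permutations in one-line notation s₁ ⋯ sₙ.
posIns : ℕ → List ℕ → List ℕ
posIns i σ = map (ξ (suc i)) (take (i ∸ 1) σ) ++ (suc i ∷ map (ξ (suc i)) (drop (i ∸ 1) σ))

negIns : ℕ → List ℕ → List ℕ
negIns i σ = map (ξ i) (take i σ) ++ (i ∷ map (ξ i) (drop i σ))

insertion : Sign → ℕ → List ℕ → List ℕ
insertion plus  = posIns
insertion minus = negIns

-- Produces T σ : σ is the permutation produced from T by the insertion
-- construction for some processing order in which every node follows its
-- non-root parent (i.e. T is built from the root by successively adding leaves).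
data Produces : RTree → List ℕ → Set where
  start : Produces (root nil nil) (2 ∷ 1 ∷ [])
  step  : ∀ {T T' σ s i} → Produces T σ → RIns s i T T' → Produces T' (insertion s i σ)

-- 1-based lookup σ(i).
at : List ℕ → ℕ → Maybe ℕ
at [] _ = nothing
at (_ ∷ _) zero = nothing
at (x ∷ _) (suc zero) = just x
at (_ ∷ xs) (suc (suc n)) = at xs (suc n)

{-# OPTIONS --safe #-}
-- Along the construction, every ascent σ(j) = j + 1 and every descent σ(j + 1) = j of
-- the cycle is witnessed, after rotations, by a leaf of sign + resp. - in relative
-- position j.  A new leaf at position p commutes with a witnessing leaf at position k
-- when the two are not adjacent (moving it to k + 1 if p < k), and when they are
-- adjacent and of the same sign one rotation at the old leaf restores a leaf in the
-- required position.  The insertion rule on permutations moves ascents and descents in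
-- exactly this way, the only new one being the inserted leaf itself, while the cases
-- that do not fit this pattern would force a fixed point of σ.  The invariant fails for
-- the root alone (σ = 21), so the induction starts from the one-leaf trees.
module Submission where

open import Defs
open import Data.Bool using (true; false)
open import Data.Empty using (⊥-elim)
open import Data.List using (List; []; _∷_; length; map; take; drop; _++_)
open import Data.List.Properties using (length-map)
open import Data.Maybe using (just)
open import Data.Nat using (ℕ; zero; suc; _+_; _∸_; _≤_; _<_; _<ᵇ_; z≤n; s≤s)
open import Data.Nat.Properties
open import Data.Product using (Σ; ∃; _×_; _,_)
open import Data.Sum using (inj₁; inj₂)
open import Relation.Binary.Construct.Closure.ReflexiveTransitive using (ε; _◅_; _◅◅_)
open import Relation.Binary.PropositionalEquality using (_≡_; _≢_; refl; sym; trans; cong; subst; module ≡-Reasoning)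
open import Relation.Nullary.Reflects using (ofʸ; ofⁿ)

variable
  a b s : Sign
  i j k p q n v w x y : ℕ
  t t' t₀ t₁ t₂ u l l' r r' : STree
  T T' U T₀ T₁ T₂ : RTree
  σ : List ℕ

ins-index-pos : Ins s i t t' → 0 < i
ins-index-pos here = s≤s z≤n
ins-index-pos (goL d) = ins-index-pos d
ins-index-pos (goR {l = l} d) = ≤-trans (ins-index-pos d) (m≤n+m _ (slots l))

ins-index≤slots : Ins s i t t' → i ≤ slots t
ins-index≤slots here = ≤-refl
ins-index≤slots (goL {r = r} d) = ≤-trans (ins-index≤slots d) (m≤m+n _ (slots r))
ins-index≤slots (goR {l = l} d) = +-monoʳ-≤ (slots l) (ins-index≤slots d)

ins-slots : Ins s i t t' → slots t' ≡ suc (slots t)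
ins-slots here = refl
ins-slots (goL {r = r} d) = cong (_+ slots r) (ins-slots d)
ins-slots (goR {l = l} d) = trans (cong (slots l +_) (ins-slots d)) (+-suc (slots l) _)

ins-left<ins-right : Ins a i l l' → Ins b j r r' → i < slots l + j
ins-left<ins-right d e = ≤-<-trans (ins-index≤slots d) (m<m+n _ (ins-index-pos e))

ins-left<ins-right′ : Ins a i l l' → Ins b j r r' → suc i < slots l' + j
ins-left<ins-right′ {j = j} d e =
  subst (λ m → suc _ < m + j) (sym (ins-slots d)) (s≤s (ins-left<ins-right d e))

goR′ : ∀ {t} → i ≡ slots l + j → Ins s j r r' → Ins s i (node t l r) (node t l r')
goR′ refl d = goR d

ins-commute-< : Ins a k t₀ t₁ → Ins b p t₁ t₂ → p < k →
                ∃ λ t → Ins b p t₀ t × Ins a (suc k) t t₂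
ins-commute-< here e p<1 = ⊥-elim (<⇒≱ p<1 (ins-index-pos e))
ins-commute-< (goL d) (goL e) p<k with ins-commute-< d e p<k
... | _ , e′ , d′ = _ , goL e′ , goL d′
ins-commute-< (goL d) (goR e) p<k =
  ⊥-elim (<-asym p<k (<-trans (n<1+n _) (ins-left<ins-right′ d e)))
ins-commute-< (goR {j} d) (goL e) _ = _ , goL e , goR′ (cong (_+ j) (sym (ins-slots e))) d
ins-commute-< (goR {j} {l = l} d) (goR e) p<k with ins-commute-< d e (+-cancelˡ-< (slots l) _ _ p<k)
... | _ , e′ , d′ = _ , goR e′ , goR′ (sym (+-suc (slots l) j)) d′

ins-commute-> : Ins a k t₀ t₁ → Ins b p t₁ t₂ → p ≡ suc q → k < q →
                ∃ λ t → Ins b q t₀ t × Ins a k t t₂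
ins-commute-> here (goL here) refl ()
ins-commute-> here (goR here) refl (s≤s ())
ins-commute-> (goL d) (goL e) p≡ k<q with ins-commute-> d e p≡ k<q
... | _ , e′ , d′ = _ , goL e′ , goL d′
ins-commute-> (goL d) (goR {j} e) p≡ _ =
  _ , goR′ (suc-injective (trans (sym p≡) (cong (_+ j) (ins-slots d)))) e , goL d
ins-commute-> (goR d) (goL e) refl k<q =
  ⊥-elim (<-asym (<-trans (n<1+n _) (ins-left<ins-right e d)) k<q)
ins-commute-> (goR d) (goR {zero} e) _ _ = ⊥-elim (n≮n 0 (ins-index-pos e))
ins-commute-> (goR {i} {l = l} d) (goR {suc j} e) p≡ k<q
  with refl ← suc-injective (trans (sym p≡) (+-suc (slots l) j))
  with ins-commute-> d e refl (+-cancelˡ-< (slots l) i j k<q)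
... | _ , e′ , d′ = _ , goR e′ , goR d′

ins-rotate-≡ : Ins a k t₀ t₁ → Ins a p t₁ t₂ → k ≡ p →
               ∃ λ t → Rot t₂ t × Ins a (suc k) t₁ t
ins-rotate-≡ here (goL here) refl = _ , rotR , goR here
ins-rotate-≡ here (goR here) ()
ins-rotate-≡ (goL d) (goL e) k≡p with ins-rotate-≡ d e k≡p
... | _ , ρ , d′ = _ , inL ρ , goL d′
ins-rotate-≡ (goL d) (goR e) k≡p = ⊥-elim (<-irrefl k≡p (<-trans (n<1+n _) (ins-left<ins-right′ d e)))
ins-rotate-≡ (goR d) (goL e) k≡p = ⊥-elim (<-irrefl (sym k≡p) (ins-left<ins-right e d))
ins-rotate-≡ (goR {i} {l = l} d) (goR {j} e) k≡p with ins-rotate-≡ d e (+-cancelˡ-≡ (slots l) i j k≡p)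
... | _ , ρ , d′ = _ , inR ρ , goR′ (sym (+-suc (slots l) i)) d′

ins-rotate-suc : Ins a k t₀ t₁ → Ins a p t₁ t₂ → p ≡ suc k →
                 ∃ λ t → Rot t₂ t × Ins a k t₁ t
ins-rotate-suc here (goR here) refl = _ , rotL , goL here
ins-rotate-suc here (goL here) ()
ins-rotate-suc (goL d) (goL e) p≡ with ins-rotate-suc d e p≡
... | _ , ρ , d′ = _ , inL ρ , goL d′
ins-rotate-suc (goL d) (goR e) p≡ = ⊥-elim (<-irrefl (sym p≡) (ins-left<ins-right′ d e))
ins-rotate-suc (goR d) (goL e) p≡ = ⊥-elim (<-irrefl p≡ (<-trans (ins-left<ins-right e d) (n<1+n _)))
ins-rotate-suc (goR {i} {l = l} d) (goR {j} e) p≡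
  with ins-rotate-suc d e (+-cancelˡ-≡ (slots l) j (suc i) (trans p≡ (sym (+-suc (slots l) i))))
... | _ , ρ , d′ = _ , inR ρ , goR d′

rot-slots : Rot t u → slots t ≡ slots u
rot-slots (rotR {a = a} {b} {c}) = +-assoc (slots a) (slots b) (slots c)
rot-slots (rotL {a = a} {b} {c}) = sym (+-assoc (slots a) (slots b) (slots c))
rot-slots (inL {r = r} ρ) = cong (_+ slots r) (rot-slots ρ)
rot-slots (inR {l = l} ρ) = cong (slots l +_) (rot-slots ρ)

rot-ins : Rot t u → Ins s p t t' → ∃ λ u' → Ins s p u u' × Rot t' u'
rot-ins rotR (goL (goL d)) = _ , goL d , rotR
rot-ins rotR (goL (goR d)) = _ , goR (goL d) , rotR
rot-ins (rotR {a = a} {b}) (goR {j} d) = _ , goR′ (+-assoc (slots a) (slots b) j) (goR d) , rotR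
rot-ins rotL (goL d) = _ , goL (goL d) , rotL
rot-ins rotL (goR (goL d)) = _ , goL (goR d) , rotL
rot-ins (rotL {a = a} {b}) (goR (goR {j} d)) = _ , goR′ (sym (+-assoc (slots a) (slots b) j)) d , rotL
rot-ins (inL ρ) (goL d) with rot-ins ρ d
... | _ , d′ , ρ′ = _ , goL d′ , inL ρ′
rot-ins (inL ρ) (goR {j} d) = _ , goR′ (cong (_+ j) (rot-slots ρ)) d , inL ρ
rot-ins (inR ρ) (goL d) = _ , goL d , inR ρ
rot-ins (inR ρ) (goR d) with rot-ins ρ d
... | _ , d′ , ρ′ = _ , goR d′ , inR ρ′

-- Insertion ignores signs, so a rooted tree can be treated as a signed one with a dummy
-- root sign; rotations of the embedded tree are allowed rotations of the rooted tree
-- (not conversely: root rotations may change signs).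
embed : RTree → STree
embed (root l r) = node plus l r

embed-ins : RIns s i T T' → Ins s i (embed T) (embed T')
embed-ins (goL d) = goL d
embed-ins (goR d) = goR d

restrict-ins : Ins s i (embed T) (embed T') → RIns s i T T'
restrict-ins {T = root _ _} {root _ _} (goL d) = goL d
restrict-ins {T = root _ _} {root _ _} (goR d) = goR d

ins-embed⁻¹ : Ins s i (embed T) t → ∃ λ T' → t ≡ embed T' × RIns s i T T'
ins-embed⁻¹ {T = root _ _} (goL d) = _ , refl , goL d
ins-embed⁻¹ {T = root _ _} (goR d) = _ , refl , goR d

rot-embed⁻¹ : Rot (embed T) t → ∃ λ T' → t ≡ embed T' × RRot T T'
rot-embed⁻¹ {T = root _ _} rotR = _ , refl , rootR
rot-embed⁻¹ {T = root _ _} rotL = _ , refl , rootL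
rot-embed⁻¹ {T = root _ _} (inL ρ) = _ , refl , inL ρ
rot-embed⁻¹ {T = root _ _} (inR ρ) = _ , refl , inR ρ

rins-commute-< : RIns a k T₀ T₁ → RIns b p T₁ T₂ → p < k →
                 ∃ λ T → RIns b p T₀ T × RIns a (suc k) T T₂
rins-commute-< d e p<k with ins-commute-< (embed-ins d) (embed-ins e) p<k
... | _ , e′ , d′ with ins-embed⁻¹ e′
...   | T , refl , e″ = T , e″ , restrict-ins d′

rins-commute-> : RIns a k T₀ T₁ → RIns b (suc q) T₁ T₂ → k < q →
                 ∃ λ T → RIns b q T₀ T × RIns a k T T₂
rins-commute-> d e k<q with ins-commute-> (embed-ins d) (embed-ins e) refl k<q
... | _ , e′ , d′ with ins-embed⁻¹ e′
...   | T , refl , e″ = T , e″ , restrict-ins d′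

rins-rotate-≡ : RIns a k T₀ T₁ → RIns a k T₁ T₂ → ∃ λ T → RRot T₂ T × RIns a (suc k) T₁ T
rins-rotate-≡ d e with ins-rotate-≡ (embed-ins d) (embed-ins e) refl
... | _ , ρ , e′ with rot-embed⁻¹ ρ
...   | T , refl , ρ′ = T , ρ′ , restrict-ins e′

rins-rotate-suc : RIns a k T₀ T₁ → RIns a (suc k) T₁ T₂ → ∃ λ T → RRot T₂ T × RIns a k T₁ T
rins-rotate-suc d e with ins-rotate-suc (embed-ins d) (embed-ins e) refl
... | _ , ρ , e′ with rot-embed⁻¹ ρ
...   | T , refl , ρ′ = T , ρ′ , restrict-ins e′

rrot-ins : RRot T U → RIns s p T T' → ∃ λ U' → RIns s p U U' × RRot T' U'
rrot-ins rootR (goL (goL d)) = _ , goL d , rootR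
rrot-ins rootR (goL (goR d)) = _ , goR (goL d) , rootR
rrot-ins (rootR {a = a} {b}) (goR {j} d) =
  _ , restrict-ins (goR′ (+-assoc (slots a) (slots b) j) (goR d)) , rootR
rrot-ins rootL (goL d) = _ , goL (goL d) , rootL
rrot-ins rootL (goR (goL d)) = _ , goL (goR d) , rootL
rrot-ins (rootL {a = a} {b}) (goR (goR {j} d)) =
  _ , restrict-ins (goR′ (sym (+-assoc (slots a) (slots b) j)) d) , rootL
rrot-ins (inL ρ) (goL d) with rot-ins ρ d
... | _ , d′ , ρ′ = _ , goL d′ , inL ρ′
rrot-ins (inL ρ) (goR {j} d) = _ , restrict-ins (goR′ (cong (_+ j) (rot-slots ρ)) d) , inL ρ
rrot-ins (inR ρ) (goL d) = _ , goL d , inR ρ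
rrot-ins (inR ρ) (goR d) with rot-ins ρ d
... | _ , d′ , ρ′ = _ , goR d′ , inR ρ′

reachable-ins : Reachable T U → RIns s p T T' → ∃ λ U' → RIns s p U U' × Reachable T' U'
reachable-ins ε d = _ , d , ε
reachable-ins (ρ ◅ ρs) d with rrot-ins ρ d
... | _ , d₁ , ρ′ with reachable-ins ρs d₁
...   | U' , d′ , ρs′ = U' , d′ , ρ′ ◅ ρs′

ReachesLeafAt : Sign → ℕ → RTree → Set
ReachesLeafAt s i T = Σ RTree λ T' → Reachable T T' × HasLeafAt s i T'

new-leaf : RIns s i T T' → ReachesLeafAt s i T'
new-leaf d = _ , ε , _ , d

reaches-ins-< : ReachesLeafAt a k T → RIns b p T T' → p < k → ReachesLeafAt a (suc k) T'
reaches-ins-< (_ , T↝U , _ , leaf) d p<k with reachable-ins T↝U d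
... | U' , d′ , T'↝U' with rins-commute-< leaf d′ p<k
...   | _ , _ , leaf′ = U' , T'↝U' , _ , leaf′

reaches-ins-> : ReachesLeafAt a k T → RIns b p T T' → suc k < p → ReachesLeafAt a k T'
reaches-ins-> (_ , T↝U , _ , leaf) d (s≤s k<q) with reachable-ins T↝U d
... | U' , d′ , T'↝U' with rins-commute-> leaf d′ k<q
...   | _ , _ , leaf′ = U' , T'↝U' , _ , leaf′

reaches-ins-≡ : ReachesLeafAt a k T → RIns a k T T' → ReachesLeafAt a (suc k) T'
reaches-ins-≡ (_ , T↝U , _ , leaf) d with reachable-ins T↝U d
... | U' , d′ , T'↝U' with rins-rotate-≡ leaf d′
...   | V , ρ , leaf′ = V , T'↝U' ◅◅ (ρ ◅ ε) , _ , leaf′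

reaches-ins-suc : ReachesLeafAt a k T → RIns a (suc k) T T' → ReachesLeafAt a k T'
reaches-ins-suc (_ , T↝U , _ , leaf) d with reachable-ins T↝U d
... | U' , d′ , T'↝U' with rins-rotate-suc leaf d′
...   | V , ρ , leaf′ = V , T'↝U' ◅◅ (ρ ◅ ε) , _ , leaf′

reaches-ins-≤ : ReachesLeafAt a k T → RIns a p T T' → p ≤ k → ReachesLeafAt a (suc k) T'
reaches-ins-≤ reach d p≤k with m≤n⇒m<n∨m≡n p≤k
... | inj₁ p<k = reaches-ins-< reach d p<k
... | inj₂ refl = reaches-ins-≡ reach d

reaches-ins-≥ : ReachesLeafAt a k T → RIns a p T T' → suc k ≤ p → ReachesLeafAt a k T'
reaches-ins-≥ reach d k<p with m≤n⇒m<n∨m≡n k<p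
... | inj₁ k+1<p = reaches-ins-> reach d k+1<p
... | inj₂ refl = reaches-ins-suc reach d

-- posIns (suc n) and negIns n unfold to insertAt n (suc (suc n)) and insertAt n n.
insertAt : ℕ → ℕ → List ℕ → List ℕ
insertAt n x σ = map (ξ x) (take n σ) ++ x ∷ map (ξ x) (drop n σ)

length-insertAt : ∀ n x σ → length (insertAt n x σ) ≡ suc (length σ)
length-insertAt zero x σ = cong suc (length-map (ξ x) σ)
length-insertAt (suc n) x [] = refl
length-insertAt (suc n) x (y ∷ σ) = cong suc (length-insertAt n x σ)

ξ-elim : ∀ (P : ℕ → Set) {x v} → (v < x → P v) → (x ≤ v → P (suc v)) → P (ξ x v)
ξ-elim P {x} {v} below above with v <ᵇ x | <ᵇ-reflects-< v x
... | true  | ofʸ v<x = below v<x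
... | false | ofⁿ v≮x = above (≮⇒≥ v≮x)

at-∷ : ∀ σ j → at σ j ≡ just v → at (y ∷ σ) (suc j) ≡ just v
at-∷ [] zero ()
at-∷ (_ ∷ _) zero ()
at-∷ _ (suc _) σj≡v = σj≡v

at-map⁻¹ : ∀ (f : ℕ → ℕ) σ j → at (map f σ) j ≡ just w → ∃ λ v → at σ j ≡ just v × f v ≡ w
at-map⁻¹ f [] _ ()
at-map⁻¹ f (y ∷ σ) zero ()
at-map⁻¹ f (y ∷ σ) (suc zero) refl = y , refl , refl
at-map⁻¹ f (y ∷ σ) (suc (suc j)) eq = at-map⁻¹ f σ (suc j) eq

-- Where the entry w at position j of insertAt n x σ comes from; the arrow marks the
-- entries of σ that ξ x has raised by one.
data Origin (n x : ℕ) (σ : List ℕ) : ℕ → ℕ → Set where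
  new     : Origin n x σ (suc n) x
  before  : j ≤ n → at σ j ≡ just v → v < x → Origin n x σ j v
  before↑ : j ≤ n → at σ j ≡ just v → x ≤ v → Origin n x σ j (suc v)
  after   : n < j → at σ j ≡ just v → v < x → Origin n x σ (suc j) v
  after↑  : n < j → at σ j ≡ just v → x ≤ v → Origin n x σ (suc j) (suc v)

origin-∷ : Origin n x σ j w → Origin (suc n) x (y ∷ σ) (suc j) w
origin-∷ new = new
origin-∷ {σ = σ} (before {j = j} j≤n e v<x) = before (s≤s j≤n) (at-∷ σ j e) v<x
origin-∷ {σ = σ} (before↑ {j = j} j≤n e x≤v) = before↑ (s≤s j≤n) (at-∷ σ j e) x≤v
origin-∷ {σ = σ} (after {j = j} n<j e v<x) = after (s≤s n<j) (at-∷ σ j e) v<x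
origin-∷ {σ = σ} (after↑ {j = j} n<j e x≤v) = after↑ (s≤s n<j) (at-∷ σ j e) x≤v

origin : ∀ {n x σ j w} → n ≤ length σ → at (insertAt n x σ) j ≡ just w → Origin n x σ j w
origin {zero} {j = zero} _ ()
origin {zero} {j = suc zero} _ refl = new
origin {zero} {x} {σ} {suc (suc j)} _ eq with at-map⁻¹ (ξ x) σ (suc j) eq
... | _ , e , refl = ξ-elim (Origin 0 x σ (suc (suc j))) (after (s≤s z≤n) e) (after↑ (s≤s z≤n) e)
origin {suc n} {σ = []} ()
origin {suc n} {σ = _ ∷ _} {zero} _ ()
origin {suc n} {x} {y ∷ σ} {suc zero} _ refl =
  ξ-elim (Origin (suc n) x (y ∷ σ) 1) (before (s≤s z≤n) refl) (before↑ (s≤s z≤n) refl)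
origin {suc n} {σ = _ ∷ _} {suc (suc j)} (s≤s n≤) eq = origin-∷ (origin n≤ eq)

FixedPointFree : List ℕ → Set
FixedPointFree σ = ∀ j → at σ j ≢ just j

insertAt-fixedPointFree : FixedPointFree σ → n ≤ length σ → n ≤ x → x ≤ suc (suc n) → x ≢ suc n →
                          FixedPointFree (insertAt n x σ)
insertAt-fixedPointFree fpf n≤ n≤x x≤ x≢ j eq with origin n≤ eq
... | new = x≢ refl
... | before _ e _ = fpf _ e
... | before↑ j≤n _ x≤v = n≮n _ (≤-trans j≤n (≤-trans n≤x x≤v))
... | after n<j _ v<x = <⇒≱ n<j (≤-pred (≤-pred (≤-trans v<x x≤)))
... | after↑ _ e _ = fpf _ e

record Witnessed (T : RTree) (σ : List ℕ) : Set where
  field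
    ascent  : ∀ j → at σ j ≡ just (suc j) → ReachesLeafAt plus j T
    descent : ∀ k → at σ (suc k) ≡ just k → ReachesLeafAt minus k T

witnessed-posIns : Witnessed T σ → FixedPointFree σ → n ≤ length σ → RIns plus (suc n) T T' →
                   Witnessed T' (posIns (suc n) σ)
witnessed-posIns {T} {σ} {n} {T'} w fpf n≤ d = record { ascent = ascent′ ; descent = descent′ }
  where
    open Witnessed w

    ascent′ : ∀ j → at (posIns (suc n) σ) j ≡ just (suc j) → ReachesLeafAt plus j T'
    ascent′ j eq with origin n≤ eq
    ... | new = new-leaf d
    ... | before j≤n e _ = reaches-ins-≥ (ascent j e) d (s≤s j≤n)
    ... | before↑ _ e _ = ⊥-elim (fpf _ e)
    ... | after n<j _ (s≤s (s≤s j<n)) = ⊥-elim (<-asym n<j j<n)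
    ... | after↑ n<j e _ = reaches-ins-≤ (ascent _ e) d n<j

    descent′ : ∀ k → at (posIns (suc n) σ) (suc k) ≡ just k → ReachesLeafAt minus k T'
    descent′ k eq with origin n≤ eq
    ... | before j≤n e _ = reaches-ins-> (descent k e) d (s≤s j≤n)
    ... | before↑ j≤n _ x≤v = ⊥-elim (<-asym (<⇒≤ j≤n) (<⇒≤ x≤v))
    ... | after _ e _ = ⊥-elim (fpf _ e)
    ... | after↑ _ e x≤v = reaches-ins-< (descent _ e) d x≤v

witnessed-negIns : Witnessed T σ → FixedPointFree σ → n ≤ length σ → RIns minus n T T' →
                   Witnessed T' (negIns n σ)
witnessed-negIns {T} {σ} {n} {T'} w fpf n≤ d = record { ascent = ascent′ ; descent = descent′ }
  where
    open Witnessed w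

    ascent′ : ∀ j → at (negIns n σ) j ≡ just (suc j) → ReachesLeafAt plus j T'
    ascent′ j eq with origin n≤ eq
    ... | before _ e v<n = reaches-ins-> (ascent j e) d v<n
    ... | before↑ _ e _ = ⊥-elim (fpf _ e)
    ... | after n<j _ v<n = ⊥-elim (<⇒≱ n<j (m+n≤o⇒n≤o 3 v<n))
    ... | after↑ n<j e _ = reaches-ins-< (ascent _ e) d n<j

    descent′ : ∀ k → at (negIns n σ) (suc k) ≡ just k → ReachesLeafAt minus k T'
    descent′ k eq with origin n≤ eq
    ... | new = new-leaf d
    ... | before j≤n e _ = reaches-ins-≥ (descent k e) d j≤n
    ... | before↑ j≤n _ n≤v = ⊥-elim (n≮n _ (≤-trans (<⇒≤ j≤n) n≤v))
    ... | after _ e _ = ⊥-elim (fpf _ e)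
    ... | after↑ _ e n≤v = reaches-ins-≤ (descent _ e) d n≤v

witnessed-step : Witnessed T σ → FixedPointFree σ → i ≤ length σ → RIns s i T T' →
                 Witnessed T' (insertion s i σ)
witnessed-step {i = zero} {s = plus} _ _ _ d = ⊥-elim (n≮n 0 (ins-index-pos (embed-ins d)))
witnessed-step {i = suc _} {s = plus} w fpf i≤ d = witnessed-posIns w fpf (<⇒≤ i≤) d
witnessed-step {s = minus} w fpf i≤ d = witnessed-negIns w fpf i≤ d

length-insertion : ∀ s i σ → length (insertion s i σ) ≡ suc (length σ)
length-insertion plus i σ = length-insertAt (i ∸ 1) (suc i) σ
length-insertion minus i σ = length-insertAt i i σ

length≡slots : Produces T σ → length σ ≡ slots (embed T)
length≡slots start = refl
length≡slots (step {T} {T'} {σ} {s} {i} pr d) = begin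
  length (insertion s i σ)  ≡⟨ length-insertion s i σ ⟩
  suc (length σ)            ≡⟨ cong suc (length≡slots pr) ⟩
  suc (slots (embed T))     ≡⟨ ins-slots (embed-ins d) ⟨
  slots (embed T')          ∎
  where open ≡-Reasoning

index≤length : Produces T σ → RIns s i T T' → i ≤ length σ
index≤length pr d = subst (_ ≤_) (sym (length≡slots pr)) (ins-index≤slots (embed-ins d))

fixedPointFree : Produces T σ → FixedPointFree σ
fixedPointFree start (suc (suc (suc _))) ()
fixedPointFree (step {s = plus} {i = zero} _ d) = ⊥-elim (n≮n 0 (ins-index-pos (embed-ins d)))
fixedPointFree (step {s = plus} {i = suc n} pr d) =
  insertAt-fixedPointFree (fixedPointFree pr) (<⇒≤ (index≤length pr d))
    (≤-trans (n≤1+n n) (n≤1+n _)) ≤-refl (λ ())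
fixedPointFree (step {s = minus} {i = n} pr d) =
  insertAt-fixedPointFree (fixedPointFree pr) (index≤length pr d)
    ≤-refl (≤-trans (n≤1+n n) (n≤1+n _)) (λ ())

witnessed-first : RIns s i (root nil nil) T' → Witnessed T' (insertion s i (2 ∷ 1 ∷ []))
witnessed-first {plus} d@(goL here) = record
  { ascent  = λ { 1 _ → new-leaf d ; 2 _ → _ , rootR ◅ ε , _ , goR here
                ; 0 () ; 3 () ; (suc (suc (suc (suc _)))) () }
  ; descent = λ { 0 () ; 1 () ; 2 () ; (suc (suc (suc _))) () } }
witnessed-first {plus} d@(goR here) = record
  { ascent  = λ { 1 _ → _ , rootL ◅ ε , _ , goL here ; 2 _ → new-leaf d
                ; 0 () ; 3 () ; (suc (suc (suc (suc _)))) () }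
  ; descent = λ { 0 () ; 1 () ; 2 () ; (suc (suc (suc _))) () } }
witnessed-first {minus} d@(goL here) = record
  { ascent  = λ { 0 () ; 1 () ; 2 () ; 3 () ; (suc (suc (suc (suc _)))) () }
  ; descent = λ { 1 _ → new-leaf d ; 2 _ → _ , rootR ◅ ε , _ , goR here
                ; 0 () ; (suc (suc (suc _))) () } }
witnessed-first {minus} d@(goR here) = record
  { ascent  = λ { 0 () ; 1 () ; 2 () ; 3 () ; (suc (suc (suc (suc _)))) () }
  ; descent = λ { 1 _ → _ , rootL ◅ ε , _ , goL here ; 2 _ → new-leaf d
                ; 0 () ; (suc (suc (suc _))) () } }

witnessed : Produces T σ → RIns s i T T' → Witnessed T' (insertion s i σ)
witnessed start d = witnessed-first d
witnessed pr@(step pr′ d′) d = witnessed-step (witnessed pr′ d′) (fixedPointFree pr) (index≤length pr d) d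

mainTheorem15 : (T : RTree) (σ : List ℕ) → Produces T σ → 3 ≤ length σ → (i : ℕ) →
    (at σ i ≡ just (suc i) → Σ RTree (λ T' → Reachable T T' × HasLeafAt plus i T')) ×
    ((k : ℕ) → at σ i ≡ just k → suc k ≡ i → Σ RTree (λ T' → Reachable T T' × HasLeafAt minus k T'))
mainTheorem15 _ _ start (s≤s (s≤s ())) _
mainTheorem15 _ _ (step pr d) _ i = ascent i , λ { k σk+1≡k refl → descent k σk+1≡k }
  where open Witnessed (witnessed pr d)
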